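{- Let $G$ be a graph on $n$ vertices with minimum degree $\delta$, and let $\tau$ be any threshold assignment for $G$ with average threshold $\bar t$. Then $dyn_\tau(G)\le \frac{n\bar t}{\delta+1}$; that is, $Dyn_{\bar t=t}(G)\le \frac{nt}{\delta+1}$.
   Context: Graphs are finite, undirected, simple. A threshold assignment for $G$ is a function $\tau:V(G)\to\mathbb{N}\cup\{0\}$ with $\tau(v)\le \deg(v)$ for every $v$; its average threshold is $\sum_v\tau(v)/|G|$. For $M\subseteq V(G)$, the $\tau$-dynamic process starting from $M$ is $D_0=M$ and, for $i\ge0$, $D_{i+1}$ = set of vertices $v\notin D_0\cup\dots\cup D_i$ with at least $\tau(v)$ neighbours in $D_0\cup\dots\cup D_i$; $M$ is a $\tau$-dynamic monopoly if $\bigcup_i D_i=V(G)$. $dyn_\tau(G)$ is the minimum size of a $\tau$-dynamic monopoly, and $Dyn_{\bar t=t}(G)$ is the maximum of $dyn_\tau(G)$ over threshold assignments with average threshold $t$. -}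

module Defs where

open import Data.Nat using (ℕ; zero; suc; _≤_; _≤ᵇ_; _*_)
open import Data.Nat.ListAction using (sum)
open import Data.Bool using (Bool; true; false; _∨_)
open import Data.Fin using (Fin)
open import Data.Fin.Subset using (Subset; ∣_∣; _∩_; ⊤)
open import Data.Vec using (tabulate; lookup; toList)
open import Data.List using (map)
open import Data.Product using (Σ; ∃; _×_)
open import Relation.Binary.PropositionalEquality using (_≡_)
open import Function using (_∘_)

record Graph (n : ℕ) : Set where
  field
    adj       : Fin n → Fin n → Bool
    symmetric : ∀ u v → adj u v ≡ adj v u
    irreflex  : ∀ v → adj v v ≡ false

module _ {n : ℕ} (G : Graph n) where
  open Graph G

  nbhd : Fin n → Subset n
  nbhd v = tabulate (adj v)

  deg : Fin n → ℕ
  deg v = ∣ nbhd v ∣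

  IsMinDegree : ℕ → Set
  IsMinDegree δ = (∀ v → δ ≤ deg v) × ∃ λ v → deg v ≡ δ

  IsThreshold : (Fin n → ℕ) → Set
  IsThreshold τ = ∀ v → τ v ≤ deg v

  -- sum of thresholds (= n · average threshold)
  totalThreshold : (Fin n → ℕ) → ℕ
  totalThreshold τ = sum (toList (tabulate τ))

  -- one round of the process: the cumulative set D_0 ∪ … ∪ D_i is
  -- extended by all vertices with ≥ τ(v) neighbours in it
  step : (Fin n → ℕ) → Subset n → Subset n
  step τ S = tabulate λ v → lookup S v ∨ (τ v ≤ᵇ ∣ nbhd v ∩ S ∣)

  -- D_0 ∪ … ∪ D_k
  reached : (Fin n → ℕ) → Subset n → ℕ → Subset n
  reached τ M zero    = M
  reached τ M (suc k) = step τ (reached τ M k)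

  IsDynMonopoly : (Fin n → ℕ) → Subset n → Set
  IsDynMonopoly τ M = ∃ λ k → reached τ M k ≡ ⊤

-- Put the vertices in a linear order and seed exactly those v with fewer than τ(v)
-- neighbours earlier in the order; every other vertex is then activated by its
-- predecessors. In a uniformly random order a vertex of degree d is seeded with
-- probability min(1, τ(v)/(d+1)) ≤ τ(v)/(δ+1). The order is derandomised from the back:
-- for the set R of vertices still to be ordered, the potential
-- Φ(R) = Σ_{w∈R} min(1, τ(w)/(d_R(w)+1)) (scaled by (n+1)! to stay in ℕ) is the expected
-- seed size, and averaging over the choice of the last vertex v ∈ R gives one with
-- [d_R(v) < τ(v)] + Φ(R ∖ v) ≤ Φ(R).
module Submission where

open import Defs
open import Data.Nat
  using (ℕ; zero; suc; pred; _+_; _*_; _⊓_; _≤_; _<_; _<ᵇ_; _≤ᵇ_; _!; _/_; z≤n; s≤s)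
open import Data.Nat.Properties hiding (_≟_)
open import Data.Nat.Divisibility using (_∣_; ∣-trans; m∣m*n; m≤n⇒m!∣n!)
open import Data.Nat.DivMod using (m*[n/m]≡n)
import Data.Nat.ListAction as List
open import Data.Bool using (Bool; true; false; not; _∧_; _∨_; T; if_then_else_)
open import Data.Bool.Properties using (T-≡; T-∨; ∧-identityʳ; ∧-commutativeMonoid)
open import Data.Fin using (Fin; zero; suc; _≟_)
open import Data.Fin.Properties using (any?)
open import Data.Fin.Subset using (Subset; ∣_∣; _∩_; ⊤)
open import Data.Fin.Subset.Properties using (∣p∣≤n)
open import Data.Vec using ([]; _∷_; tabulate; lookup; toList)
open import Data.Vec.Properties using (lookup∘tabulate; lookup-zipWith)
open import Data.Product using (∃; _×_; _,_)
open import Data.Sum using (inj₁; inj₂)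
open import Data.Empty using (⊥-elim)
open import Function using (_∘_; Equivalence)
open import Relation.Nullary using (does; yes; no; _×-dec_)
open import Relation.Nullary.Decidable using (T?; dec-true; dec-false)
open import Relation.Nullary.Reflects using (ofʸ; ofⁿ)
open import Relation.Unary using (_⊆_)
open import Relation.Binary.PropositionalEquality
open import Algebra.Properties.Semiring.Sum +-*-semiring
  using ( sum; sum-syntax; ∑-distrib-+; ∑-comm; *-distribˡ-sum; *-distribʳ-sum
        ; sum-cong-≗; sum-replicate-zero)
open import Algebra.Properties.CommutativeSemigroup +-commutativeSemigroup
  using () renaming (x∙yz≈y∙xz to +-leftComm)
open import Algebra.Properties.CommutativeSemigroup *-commutativeSemigroup
  using () renaming (x∙yz≈y∙xz to *-leftComm)
open import Algebra.Bundles using (CommutativeMonoid)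
open import Algebra.Properties.CommutativeSemigroup
  (CommutativeMonoid.commutativeSemigroup ∧-commutativeMonoid)
  using () renaming (x∙yz≈y∙xz to ∧-leftComm)

𝟙 : Bool → ℕ
𝟙 true  = 1
𝟙 false = 0

𝟙*-cong : ∀ b {x y} → (T b → x ≡ y) → 𝟙 b * x ≡ 𝟙 b * y
𝟙*-cong true  x≡y = cong (1 *_) (x≡y _)
𝟙*-cong false _   = refl

𝟙*-swap : ∀ a b c x → 𝟙 a * (𝟙 (c ∧ b) * x) ≡ 𝟙 b * (𝟙 (c ∧ a) * x)
𝟙*-swap true  true  c     x = refl
𝟙*-swap true  false true  x = refl
𝟙*-swap true  false false x = refl
𝟙*-swap false true  true  x = refl
𝟙*-swap false true  false x = refl
𝟙*-swap false false c     x = refl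

∑-mono-≤ : ∀ {n} {f g : Fin n → ℕ} → (∀ i → f i ≤ g i) → sum f ≤ sum g
∑-mono-≤ {zero}  f≤g = z≤n
∑-mono-≤ {suc n} f≤g = +-mono-≤ (f≤g zero) (∑-mono-≤ (f≤g ∘ suc))

∑-tabulate : ∀ {n} (f : Fin n → ℕ) → List.sum (toList (tabulate f)) ≡ sum f
∑-tabulate {zero}  f = refl
∑-tabulate {suc n} f = cong (f zero +_) (∑-tabulate (f ∘ suc))

count : ∀ {n} → (Fin n → Bool) → ℕ
count {n} p = ∑[ i < n ] 𝟙 (p i)

∑-𝟙* : ∀ {n} (p : Fin n → Bool) x → ∑[ i < n ] (𝟙 (p i) * x) ≡ count p * x
∑-𝟙* p x = sym (*-distribʳ-sum x (𝟙 ∘ p))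

count-≤ : ∀ {n} (p : Fin n → Bool) → count p ≤ n
count-≤ {zero}  p = z≤n
count-≤ {suc n} p with p zero
... | true  = s≤s (count-≤ (p ∘ suc))
... | false = m≤n⇒m≤1+n (count-≤ (p ∘ suc))

count-mono : ∀ {n} {p q : Fin n → Bool} → T ∘ p ⊆ T ∘ q → count p ≤ count q
count-mono {p = p} {q} p⊆q = ∑-mono-≤ 𝟙-mono
  where
  𝟙-mono : ∀ i → 𝟙 (p i) ≤ 𝟙 (q i)
  𝟙-mono i with p i | q i | p⊆q {i}
  ... | false | _     | _    = z≤n
  ... | true  | true  | _    = ≤-refl
  ... | true  | false | p⊆qᵢ = ⊥-elim (p⊆qᵢ _)

count-≟ : ∀ {n} (w : Fin n) → count (λ v → does (w ≟ v)) ≡ 1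
count-≟ {suc n} zero    = cong suc (sum-replicate-zero n)
count-≟ {suc n} (suc w) = count-≟ w

everyone : ∀ {n} → Fin n → Bool
everyone _ = true

count-everyone : ∀ n → count (everyone {n}) ≡ n
count-everyone zero    = refl
count-everyone (suc n) = cong suc (count-everyone n)

∣p∣≡count : ∀ {n} (p : Subset n) → ∣ p ∣ ≡ count (lookup p)
∣p∣≡count []          = refl
∣p∣≡count (true ∷ p)  = cong suc (∣p∣≡count p)
∣p∣≡count (false ∷ p) = ∣p∣≡count p

∣tabulate∣≡count : ∀ {n} (p : Fin n → Bool) → ∣ tabulate p ∣ ≡ count p
∣tabulate∣≡count p =
  trans (∣p∣≡count (tabulate p)) (sum-cong-≗ (cong 𝟙 ∘ lookup∘tabulate p))

everywhere⇒⊤ : ∀ {n} (S : Subset n) → (∀ v → T (lookup S v)) → S ≡ ⊤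
everywhere⇒⊤ []      _  = refl
everywhere⇒⊤ (x ∷ S) Sᵥ =
  cong₂ _∷_ (Equivalence.to T-≡ (Sᵥ zero)) (everywhere⇒⊤ S (Sᵥ ∘ suc))

_∖_ : ∀ {n} → (Fin n → Bool) → Fin n → Fin n → Bool
(p ∖ v) i = not (does (i ≟ v)) ∧ p i

insert : ∀ {n} → Fin n → (Fin n → Bool) → Fin n → Bool
insert v p i = does (i ≟ v) ∨ p i

count-remove : ∀ {n} (p : Fin n → Bool) v → count p ≡ 𝟙 (p v) + count (p ∖ v)
count-remove {suc n} p zero    = refl
count-remove {suc n} p (suc v) =
  trans (cong (𝟙 (p zero) +_) (count-remove (p ∘ suc) v))
        (+-leftComm (𝟙 (p zero)) (𝟙 (p (suc v))) (count ((p ∘ suc) ∖ v)))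

count-∖ : ∀ {n} (p : Fin n → Bool) {v} → T (p v) → count p ≡ suc (count (p ∖ v))
count-∖ p {v} pᵥ with p v | count-remove p v
... | true | eq = eq

count-insert : ∀ {n} (p : Fin n → Bool) v → count (insert v p) ≤ suc (count p)
count-insert p v = begin
  count (insert v p)                         ≡⟨ count-remove (insert v p) v ⟩
  𝟙 (insert v p v) + count (insert v p ∖ v)  ≤⟨ +-mono-≤ (𝟙-≤1 (insert v p v)) removed≤p ⟩
  suc (count p)                              ∎
  where
  open ≤-Reasoning
  𝟙-≤1 : ∀ b → 𝟙 b ≤ 1
  𝟙-≤1 true  = ≤-refl
  𝟙-≤1 false = z≤n
  removed⊆p : T ∘ (insert v p ∖ v) ⊆ T ∘ p
  removed⊆p {i} with i ≟ v
  ... | yes _ = λ ()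
  ... | no  _ = λ pᵢ → pᵢ
  removed≤p : count (insert v p ∖ v) ≤ count p
  removed≤p = count-mono {p = insert v p ∖ v} removed⊆p

∖-∈ : ∀ {n} (p : Fin n → Bool) {u v} → u ≢ v → T (p u) → T ((p ∖ v) u)
∖-∈ p {u} {v} u≢v pᵤ rewrite dec-false (u ≟ v) u≢v = pᵤ

insert-∋ : ∀ {n} (p : Fin n → Bool) v → T (insert v p v)
insert-∋ p v rewrite dec-true (v ≟ v) refl = _

insert-⊇ : ∀ {n} (p : Fin n → Bool) v → T ∘ p ⊆ T ∘ insert v p
insert-⊇ p v pᵤ = Equivalence.from T-∨ (inj₂ pᵤ)

∃-below-average : ∀ {n} (p : Fin n → Bool) (f : Fin n → ℕ) b →
  ∑[ i < n ] (𝟙 (p i) * f i) ≤ count p * b → 0 < count p → ∃ λ i → T (p i) × f i ≤ b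
∃-below-average {n} p f b avg≤ pos with any? (λ i → T? (p i) ×-dec (f i ≤? b))
... | yes found = found
... | no  none  = ⊥-elim (<⇒≱ (m<n+m (count p * b) pos) (begin
  count p + count p * b         ≡⟨ *-suc (count p) b ⟨
  count p * suc b               ≡⟨ ∑-𝟙* p (suc b) ⟨
  ∑[ i < n ] (𝟙 (p i) * suc b)  ≤⟨ ∑-mono-≤ above ⟩
  ∑[ i < n ] (𝟙 (p i) * f i)    ≤⟨ avg≤ ⟩
  count p * b                   ∎))
  where
  open ≤-Reasoning
  above : ∀ i → 𝟙 (p i) * suc b ≤ 𝟙 (p i) * f i
  above i with p i in pᵢ
  ... | false = z≤n
  ... | true  = *-monoʳ-≤ 1 (≰⇒> λ fᵢ≤b → none (i , subst T (sym pᵢ) _ , fᵢ≤b))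

module Weights (n : ℕ) where

  scale : ℕ
  scale = suc n !

  -- scale · min(1, t/(d+1)); the division is exact for d ≤ n.
  weight : ℕ → ℕ → ℕ
  weight t d = scale / suc d * (suc d ⊓ t)

  cost : ℕ → ℕ → ℕ
  cost t d = if d <ᵇ t then scale else 0

  suc*weight : ∀ t {d} → d ≤ n → suc d * weight t d ≡ scale * (suc d ⊓ t)
  suc*weight t {d} d≤n = begin
    suc d * (scale / suc d * (suc d ⊓ t))  ≡⟨ *-assoc (suc d) (scale / suc d) (suc d ⊓ t) ⟨
    suc d * (scale / suc d) * (suc d ⊓ t)  ≡⟨ cong (_* (suc d ⊓ t)) (m*[n/m]≡n 1+d∣scale) ⟩
    scale * (suc d ⊓ t)                    ∎
    where
    open ≡-Reasoning
    1+d∣scale : suc d ∣ scale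
    1+d∣scale = ∣-trans (m∣m*n (d !)) (m≤n⇒m!∣n! (s≤s d≤n))

  pred*weight : ∀ t {d} → d ≤ n → d * weight t (pred d) ≡ scale * (d ⊓ t)
  pred*weight t {zero}  _   = sym (*-zeroʳ scale)
  pred*weight t {suc d} d<n = suc*weight t (<⇒≤ d<n)

  cost+scale*⊓ : ∀ t d → cost t d + scale * (d ⊓ t) ≡ scale * (suc d ⊓ t)
  cost+scale*⊓ t d with d <ᵇ t | <ᵇ-reflects-< d t
  ... | true  | ofʸ d<t = begin
    scale + scale * (d ⊓ t)  ≡⟨ cong (λ m → scale + scale * m) (m≤n⇒m⊓n≡m (<⇒≤ d<t)) ⟩
    scale + scale * d        ≡⟨ *-suc scale d ⟨
    scale * suc d            ≡⟨ cong (scale *_) (m≤n⇒m⊓n≡m d<t) ⟨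
    scale * (suc d ⊓ t)      ∎
    where open ≡-Reasoning
  ... | false | ofⁿ d≮t =
    cong (scale *_) (trans (m≥n⇒m⊓n≡n t≤d) (sym (m≥n⇒m⊓n≡n (m≤n⇒m≤1+n t≤d))))
    where
    t≤d : t ≤ d
    t≤d = ≮⇒≥ d≮t

  cost+pred*weight : ∀ t {d} → d ≤ n → cost t d + d * weight t (pred d) ≡ suc d * weight t d
  cost+pred*weight t {d} d≤n = begin
    cost t d + d * weight t (pred d)  ≡⟨ cong (cost t d +_) (pred*weight t d≤n) ⟩
    cost t d + scale * (d ⊓ t)        ≡⟨ cost+scale*⊓ t d ⟩
    scale * (suc d ⊓ t)               ≡⟨ suc*weight t d≤n ⟨
    suc d * weight t d                ∎
    where open ≡-Reasoning

  *weight-≤ : ∀ {δ t d} → δ ≤ d → t ≤ d → d ≤ n → (δ + 1) * weight t d ≤ scale * t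
  *weight-≤ {δ} {t} {d} δ≤d t≤d d≤n = begin
    (δ + 1) * weight t d  ≤⟨ *-monoˡ-≤ (weight t d) (≤-trans (≤-reflexive (+-comm δ 1)) (s≤s δ≤d)) ⟩
    suc d * weight t d    ≡⟨ suc*weight t d≤n ⟩
    scale * (suc d ⊓ t)   ≡⟨ cong (scale *_) (m≥n⇒m⊓n≡n (m≤n⇒m≤1+n t≤d)) ⟩
    scale * t             ∎
    where open ≤-Reasoning

module _ {n : ℕ} (G : Graph n) where
  open Graph G

  neighboursIn : (Fin n → Bool) → Fin n → Fin n → Bool
  neighboursIn R w u = adj w u ∧ R u

  nonNeighboursIn : (Fin n → Bool) → Fin n → Fin n → Bool
  nonNeighboursIn R w u = not (does (w ≟ u)) ∧ (R u ∧ not (adj w u))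

  degreeIn : (Fin n → Bool) → Fin n → ℕ
  degreeIn R w = count (neighboursIn R w)

  ∣nbhd∩S∣≡degreeIn : ∀ w (S : Subset n) → ∣ nbhd G w ∩ S ∣ ≡ degreeIn (lookup S) w
  ∣nbhd∩S∣≡degreeIn w S = trans (∣p∣≡count (nbhd G w ∩ S)) (sum-cong-≗ λ u → cong 𝟙 (begin
    lookup (nbhd G w ∩ S) u           ≡⟨ lookup-zipWith _∧_ u (nbhd G w) S ⟩
    lookup (nbhd G w) u ∧ lookup S u  ≡⟨ cong (_∧ lookup S u) (lookup∘tabulate (adj w) u) ⟩
    adj w u ∧ lookup S u              ∎))
    where open ≡-Reasoning

  degreeIn-everyone : ∀ w → degreeIn everyone w ≡ deg G w
  degreeIn-everyone w = sym (trans (∣tabulate∣≡count (adj w))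
                                   (sum-cong-≗ λ u → cong 𝟙 (sym (∧-identityʳ (adj w u)))))

  degreeIn-mono : ∀ {R R′} → T ∘ R ⊆ T ∘ R′ → ∀ w → degreeIn R w ≤ degreeIn R′ w
  degreeIn-mono {R} {R′} R⊆R′ w = count-mono {p = neighboursIn R w} N⊆N′
    where
    N⊆N′ : T ∘ neighboursIn R w ⊆ T ∘ neighboursIn R′ w
    N⊆N′ {u} with adj w u
    ... | true  = R⊆R′
    ... | false = λ ()

  degreeIn-∖ : ∀ R v w → degreeIn R w ≡ 𝟙 (adj w v ∧ R v) + degreeIn (R ∖ v) w
  degreeIn-∖ R v w = trans (count-remove (neighboursIn R w) v) (cong (𝟙 (adj w v ∧ R v) +_)
    (sum-cong-≗ λ u → cong 𝟙 (∧-leftComm (not (does (u ≟ v))) (adj w u) (R u))))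

  degreeIn-∖-self : ∀ R v → degreeIn (R ∖ v) v ≡ degreeIn R v
  degreeIn-∖-self R v rewrite degreeIn-∖ R v v | irreflex v = refl

  count-around : ∀ R {w} → T (R w) → count R ≡ suc (degreeIn R w + count (nonNeighboursIn R w))
  count-around R {w} Rw = begin
    count R
      ≡⟨ sum-cong-≗ split ⟩
    ∑[ v < n ] (𝟙 (does (w ≟ v)) + (𝟙 (N v) + 𝟙 (F v)))
      ≡⟨ ∑-distrib-+ (𝟙 ∘ does ∘ (w ≟_)) (λ v → 𝟙 (N v) + 𝟙 (F v)) ⟩
    count (does ∘ (w ≟_)) + ∑[ v < n ] (𝟙 (N v) + 𝟙 (F v))
      ≡⟨ cong₂ _+_ (count-≟ w) (∑-distrib-+ (𝟙 ∘ N) (𝟙 ∘ F)) ⟩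
    suc (degreeIn R w + count F)
      ∎
    where
    open ≡-Reasoning
    N F : Fin n → Bool
    N = neighboursIn R w
    F = nonNeighboursIn R w
    split : ∀ v → 𝟙 (R v) ≡ 𝟙 (does (w ≟ v)) + (𝟙 (N v) + 𝟙 (F v))
    split v with w ≟ v
    ... | yes refl rewrite Equivalence.to T-≡ Rw | irreflex w = refl
    ... | no _ with adj w v | R v
    ...   | true  | true  = refl
    ...   | true  | false = refl
    ...   | false | true  = refl
    ...   | false | false = refl

  module _ (τ : Fin n → ℕ) where

    lookup-step : ∀ S v → lookup (step G τ S) v ≡ lookup S v ∨ (τ v ≤ᵇ ∣ nbhd G v ∩ S ∣)
    lookup-step S v = lookup∘tabulate _ v

    step-⊇ : ∀ S → T ∘ lookup S ⊆ T ∘ lookup (step G τ S)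
    step-⊇ S {v} Sᵥ = subst T (sym (lookup-step S v)) (Equivalence.from T-∨ (inj₁ Sᵥ))

    step-activates : ∀ S {v} → τ v ≤ degreeIn (lookup S) v → T (lookup (step G τ S) v)
    step-activates S {v} τ≤d = subst T (sym (lookup-step S v)) (Equivalence.from T-∨ (inj₂
      (≤⇒≤ᵇ (subst (τ v ≤_) (sym (∣nbhd∩S∣≡degreeIn v S)) τ≤d))))

    step-mono : ∀ {S S′} → T ∘ lookup S ⊆ T ∘ lookup S′ →
                T ∘ lookup (step G τ S) ⊆ T ∘ lookup (step G τ S′)
    step-mono {S} {S′} S⊆S′ {v} v∈ with Equivalence.to T-∨ (subst T (lookup-step S v) v∈)
    ... | inj₁ Sᵥ = step-⊇ S′ (S⊆S′ Sᵥ)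
    ... | inj₂ τ≤ = step-activates S′
      (≤-trans (subst (τ v ≤_) (∣nbhd∩S∣≡degreeIn v S) (≤ᵇ⇒≤ _ _ τ≤)) (degreeIn-mono S⊆S′ v))

    reached-⊇ : ∀ M k → T ∘ lookup M ⊆ T ∘ lookup (reached G τ M k)
    reached-⊇ M zero    Mᵥ = Mᵥ
    reached-⊇ M (suc k) Mᵥ = step-⊇ (reached G τ M k) (reached-⊇ M k Mᵥ)

    reached-mono : ∀ {M M′} k → T ∘ lookup M ⊆ T ∘ lookup M′ →
                   T ∘ lookup (reached G τ M k) ⊆ T ∘ lookup (reached G τ M′ k)
    reached-mono zero    M⊆M′ = M⊆M′
    reached-mono (suc k) M⊆M′ = step-mono (reached-mono k M⊆M′)

    open Weights n

    potential : (Fin n → Bool) → ℕ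
    potential R = ∑[ w < n ] (𝟙 (R w) * weight (τ w) (degreeIn R w))

    costAt : (Fin n → Bool) → Fin n → ℕ
    costAt R v = cost (τ v) (degreeIn R v)

    -- The w-th column of the double sum Σ_{v ∈ R} Φ(R ∖ v).
    weightAfterRemovals : (Fin n → Bool) → Fin n → ℕ
    weightAfterRemovals R w =
      ∑[ v < n ] (𝟙 (not (does (w ≟ v)) ∧ R v) * weight (τ w) (degreeIn (R ∖ v) w))

    cost+weightAfterRemovals : ∀ R {w} → T (R w) →
      costAt R w + weightAfterRemovals R w ≡ count R * weight (τ w) (degreeIn R w)
    cost+weightAfterRemovals R {w} Rw = begin
      costAt R w + weightAfterRemovals R w
        ≡⟨ cong (costAt R w +_) (trans (sum-cong-≗ split) (∑-distrib-+ (λ v → 𝟙 (N v) * W (pred d))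
                                                                      (λ v → 𝟙 (F v) * W d))) ⟩
      costAt R w + (∑[ v < n ] (𝟙 (N v) * W (pred d)) + ∑[ v < n ] (𝟙 (F v) * W d))
        ≡⟨ cong (costAt R w +_) (cong₂ _+_ (∑-𝟙* N (W (pred d))) (∑-𝟙* F (W d))) ⟩
      costAt R w + (d * W (pred d) + c * W d)
        ≡⟨ +-assoc (costAt R w) (d * W (pred d)) (c * W d) ⟨
      costAt R w + d * W (pred d) + c * W d
        ≡⟨ cong (_+ c * W d) (cost+pred*weight (τ w) (count-≤ N)) ⟩
      suc d * W d + c * W d
        ≡⟨ *-distribʳ-+ (W d) (suc d) c ⟨
      suc (d + c) * W d
        ≡⟨ cong (_* W d) (count-around R Rw) ⟨
      count R * W d
        ∎
      where
      open ≡-Reasoning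
      N F : Fin n → Bool
      N = neighboursIn R w
      F = nonNeighboursIn R w
      W : ℕ → ℕ
      W = weight (τ w)
      d c : ℕ
      d = degreeIn R w
      c = count F
      split : ∀ v → 𝟙 (not (does (w ≟ v)) ∧ R v) * W (degreeIn (R ∖ v) w)
                  ≡ 𝟙 (N v) * W (pred d) + 𝟙 (F v) * W d
      split v with w ≟ v
      ... | yes refl rewrite irreflex w = refl
      ... | no _ with adj w v | R v | degreeIn-∖ R v w
      ...   | true  | true  | d≡1+d′ rewrite d≡1+d′ = sym (+-identityʳ _)
      ...   | true  | false | _      = refl
      ...   | false | true  | d≡d′   rewrite d≡d′ = refl
      ...   | false | false | _      = refl

    potential-average : ∀ R →
      ∑[ v < n ] (𝟙 (R v) * (costAt R v + potential (R ∖ v))) ≡ count R * potential R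
    potential-average R = begin
      ∑[ v < n ] (𝟙 (R v) * (costAt R v + potential (R ∖ v)))
        ≡⟨ sum-cong-≗ (λ v → *-distribˡ-+ (𝟙 (R v)) (costAt R v) (potential (R ∖ v))) ⟩
      ∑[ v < n ] (𝟙 (R v) * costAt R v + 𝟙 (R v) * potential (R ∖ v))
        ≡⟨ ∑-distrib-+ (λ v → 𝟙 (R v) * costAt R v) (λ v → 𝟙 (R v) * potential (R ∖ v)) ⟩
      ∑[ v < n ] (𝟙 (R v) * costAt R v) + ∑[ v < n ] (𝟙 (R v) * potential (R ∖ v))
        ≡⟨ cong (∑[ v < n ] (𝟙 (R v) * costAt R v) +_) exchange ⟩
      ∑[ w < n ] (𝟙 (R w) * costAt R w) + ∑[ w < n ] (𝟙 (R w) * weightAfterRemovals R w)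
        ≡⟨ ∑-distrib-+ (λ w → 𝟙 (R w) * costAt R w) (λ w → 𝟙 (R w) * weightAfterRemovals R w) ⟨
      ∑[ w < n ] (𝟙 (R w) * costAt R w + 𝟙 (R w) * weightAfterRemovals R w)
        ≡⟨ sum-cong-≗ (λ w → trans (sym (*-distribˡ-+ (𝟙 (R w)) _ _))
                                   (𝟙*-cong (R w) (cost+weightAfterRemovals R))) ⟩
      ∑[ w < n ] (𝟙 (R w) * (count R * weight (τ w) (degreeIn R w)))
        ≡⟨ sum-cong-≗ (λ w → *-leftComm (𝟙 (R w)) (count R) _) ⟩
      ∑[ w < n ] (count R * (𝟙 (R w) * weight (τ w) (degreeIn R w)))
        ≡⟨ *-distribˡ-sum (count R) (λ w → 𝟙 (R w) * weight (τ w) (degreeIn R w)) ⟨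
      count R * potential R
        ∎
      where
      open ≡-Reasoning
      exchange : ∑[ v < n ] (𝟙 (R v) * potential (R ∖ v))
               ≡ ∑[ w < n ] (𝟙 (R w) * weightAfterRemovals R w)
      exchange = begin
        ∑[ v < n ] (𝟙 (R v) * potential (R ∖ v))
          ≡⟨ sum-cong-≗ (λ v → *-distribˡ-sum (𝟙 (R v)) (λ w → 𝟙 ((R ∖ v) w) * X v w)) ⟩
        ∑[ v < n ] ∑[ w < n ] (𝟙 (R v) * (𝟙 ((R ∖ v) w) * X v w))
          ≡⟨ ∑-comm (λ v w → 𝟙 (R v) * (𝟙 ((R ∖ v) w) * X v w)) ⟩
        ∑[ w < n ] ∑[ v < n ] (𝟙 (R v) * (𝟙 ((R ∖ v) w) * X v w))
          ≡⟨ sum-cong-≗ (λ w → sum-cong-≗ λ v → 𝟙*-swap (R v) (R w) (not (does (w ≟ v))) (X v w)) ⟩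
        ∑[ w < n ] ∑[ v < n ] (𝟙 (R w) * (𝟙 (not (does (w ≟ v)) ∧ R v) * X v w))
          ≡⟨ sum-cong-≗ (λ w → *-distribˡ-sum (𝟙 (R w)) λ v → 𝟙 (not (does (w ≟ v)) ∧ R v) * X v w) ⟨
        ∑[ w < n ] (𝟙 (R w) * weightAfterRemovals R w)
          ∎
        where
        X : Fin n → Fin n → ℕ
        X v w = weight (τ w) (degreeIn (R ∖ v) w)

    potential-descent : ∀ R → 0 < count R →
                        ∃ λ v → T (R v) × costAt R v + potential (R ∖ v) ≤ potential R
    potential-descent R = ∃-below-average R (λ v → costAt R v + potential (R ∖ v)) (potential R)
                                       (≤-reflexive (potential-average R))

    record Seed (R : Fin n → Bool) : Set where
      field
        seed   : Fin n → Bool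
        rounds : ℕ
        covers : T ∘ R ⊆ T ∘ lookup (reached G τ (tabulate seed) rounds)
        cheap  : scale * count seed ≤ potential R

    seed-∅ : ∀ R → count R ≡ 0 → Seed R
    seed-∅ R R≡∅ = record
      { seed   = λ _ → false
      ; rounds = 0
      ; covers = λ Rᵥ → ⊥-elim (1+n≢0 (trans (sym (count-∖ R Rᵥ)) R≡∅))
      ; cheap  = ≤-trans (≤-reflexive (trans (cong (scale *_) (sum-replicate-zero n)) (*-zeroʳ scale)))
                         z≤n
      }

    seed-extend : ∀ R {v} → T (R v) → costAt R v + potential (R ∖ v) ≤ potential R →
                  Seed (R ∖ v) → Seed R
    seed-extend R {v} Rᵥ drop S with degreeIn R v <ᵇ τ v | <ᵇ-reflects-< (degreeIn R v) (τ v)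
    ... | true | ofʸ _ = record { seed = insert v M ; rounds = k ; covers = covers′ ; cheap = cheap′ }
      where
      open Seed S renaming (seed to M; rounds to k)
      M⊆M′ : T ∘ lookup (tabulate M) ⊆ T ∘ lookup (tabulate (insert v M))
      M⊆M′ {u} rewrite lookup∘tabulate M u | lookup∘tabulate (insert v M) u = insert-⊇ M v
      covers′ : T ∘ R ⊆ T ∘ lookup (reached G τ (tabulate (insert v M)) k)
      covers′ {u} Rᵤ with u ≟ v
      ... | yes refl = reached-⊇ (tabulate (insert v M)) k
                         (subst T (sym (lookup∘tabulate (insert v M) u)) (insert-∋ M u))
      ... | no u≢v   = reached-mono k M⊆M′ (covers (∖-∈ R u≢v Rᵤ))
      cheap′ : scale * count (insert v M) ≤ potential R
      cheap′ = begin
        scale * count (insert v M)  ≤⟨ *-monoʳ-≤ scale (count-insert M v) ⟩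
        scale * suc (count M)       ≡⟨ *-suc scale (count M) ⟩
        scale + scale * count M     ≤⟨ +-monoʳ-≤ scale cheap ⟩
        scale + potential (R ∖ v)   ≤⟨ drop ⟩
        potential R                 ∎
        where open ≤-Reasoning
    ... | false | ofⁿ notBelow =
      record { seed = M ; rounds = suc k ; covers = covers′ ; cheap = ≤-trans cheap drop }
      where
      open Seed S renaming (seed to M; rounds to k)
      covers′ : T ∘ R ⊆ T ∘ lookup (reached G τ (tabulate M) (suc k))
      covers′ {u} Rᵤ with u ≟ v
      ... | yes refl = step-activates (reached G τ (tabulate M) k) (begin
        τ u                                                     ≤⟨ ≮⇒≥ notBelow ⟩
        degreeIn R u                                            ≡⟨ degreeIn-∖-self R u ⟨
        degreeIn (R ∖ u) u                                      ≤⟨ degreeIn-mono covers u ⟩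
        degreeIn (lookup (reached G τ (tabulate M) k)) u        ∎)
        where open ≤-Reasoning
      ... | no u≢v = step-⊇ (reached G τ (tabulate M) k) (covers (∖-∈ R u≢v Rᵤ))

    seed-for : ∀ m R → count R ≡ m → Seed R
    seed-for zero    R R≡0   = seed-∅ R R≡0
    seed-for (suc m) R R≡1+m with potential-descent R (subst (0 <_) (sym R≡1+m) (s≤s z≤n))
    ... | v , Rᵥ , drop =
      seed-extend R Rᵥ drop (seed-for m (R ∖ v) (suc-injective (trans (sym (count-∖ R Rᵥ)) R≡1+m)))

    potential-everyone-≤ : ∀ δ → (∀ w → δ ≤ deg G w) → IsThreshold G τ →
                           (δ + 1) * potential everyone ≤ scale * sum τ
    potential-everyone-≤ δ δ≤deg τ≤deg = begin
      (δ + 1) * potential everyone      ≡⟨ *-distribˡ-sum (δ + 1) (λ w → 1 * W w) ⟩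
      ∑[ w < n ] ((δ + 1) * (1 * W w))  ≤⟨ ∑-mono-≤ bound ⟩
      ∑[ w < n ] (scale * τ w)          ≡⟨ *-distribˡ-sum scale τ ⟨
      scale * sum τ                     ∎
      where
      open ≤-Reasoning
      W : Fin n → ℕ
      W w = weight (τ w) (degreeIn everyone w)
      bound : ∀ w → (δ + 1) * (1 * W w) ≤ scale * τ w
      bound w rewrite *-identityˡ (W w) | degreeIn-everyone w =
        *weight-≤ (δ≤deg w) (τ≤deg w) (∣p∣≤n (nbhd G w))

    seed-size-≤ : ∀ δ → (∀ w → δ ≤ deg G w) → IsThreshold G τ →
                  (S : Seed everyone) → count (Seed.seed S) * (δ + 1) ≤ sum τ
    seed-size-≤ δ δ≤deg τ≤deg S = *-cancelˡ-≤ scale {{suc n !≢0}} (begin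
      scale * (count M * (δ + 1))   ≡⟨ cong (scale *_) (*-comm (count M) (δ + 1)) ⟩
      scale * ((δ + 1) * count M)   ≡⟨ *-leftComm scale (δ + 1) (count M) ⟩
      (δ + 1) * (scale * count M)   ≤⟨ *-monoʳ-≤ (δ + 1) (Seed.cheap S) ⟩
      (δ + 1) * potential everyone  ≤⟨ potential-everyone-≤ δ δ≤deg τ≤deg ⟩
      scale * sum τ                 ∎)
      where
      open ≤-Reasoning
      M : Fin n → Bool
      M = Seed.seed S

corollary5 : ∀ {n : ℕ} (G : Graph n) (δ : ℕ) → IsMinDegree G δ →
    (τ : Fin n → ℕ) → IsThreshold G τ →
    ∃ λ (M : Subset n) → IsDynMonopoly G τ M × ∣ M ∣ * (δ + 1) ≤ totalThreshold G τ
corollary5 {n} G δ (δ≤deg , _) τ τ≤deg =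
  tabulate seed , (rounds , everywhere⇒⊤ _ (λ _ → covers _)) ,
  subst₂ (λ m t → m * (δ + 1) ≤ t) (sym (∣tabulate∣≡count seed)) (sym (∑-tabulate τ))
         (seed-size-≤ G τ δ δ≤deg τ≤deg S)
  where
  S : Seed G τ everyone
  S = seed-for G τ n everyone (count-everyone n)
  open Seed S
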